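{- Let $(P_n)$ be the Pell numbers, $P_0=0$, $P_1=1$, $P_{n+2}=2P_{n+1}+P_n$, and $(Q_n)$ the Pell–Lucas numbers, $Q_0=2$, $Q_1=2$, $Q_{n+2}=2Q_{n+1}+Q_n$. Then for every nonnegative integer $m$ and every real $c\neq0$, \[ c^{m+1}P_{m+1}=\sum_{i=0}^{m}c^{i}\left\{P_{i}+(c-2)P_{i+1}+Q_{i}\right\}, \] and in particular \[ 2^{m+1}P_{m+1}=\sum_{i=0}^{m}2^{i}\left\{P_{i}+Q_{i}\right\}. \] -}

module Defs where

open import Data.Nat using (ℕ; zero; suc)
open import Algebra.Bundles using (CommutativeRing)

-- Pell and Pell–Lucas numbers, powers and finite sums, interpreted in an
-- arbitrary commutative ring R (the paper's setting is R = ℝ).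
module PellRing {a ℓ} (R : CommutativeRing a ℓ) where
  open CommutativeRing R hiding (zero)

  two : Carrier
  two = 1# + 1#

  pell : ℕ → Carrier
  pell zero = 0#
  pell (suc zero) = 1#
  pell (suc (suc n)) = two * pell (suc n) + pell n

  pellLucas : ℕ → Carrier
  pellLucas zero = two
  pellLucas (suc zero) = two
  pellLucas (suc (suc n)) = two * pellLucas (suc n) + pellLucas n

  pow : Carrier → ℕ → Carrier
  pow x zero = 1#
  pow x (suc n) = x * pow x n

  sumTo : (ℕ → Carrier) → ℕ → Carrier
  sumTo f zero = f 0
  sumTo f (suc m) = sumTo f m + f (suc m)

{-# OPTIONS --safe #-}
module Submission where

-- Both identities telescope.  From the companion identity Q_i + 2 P_i = 2 P_{i+1}
-- the i-th summand equals c^{i+1} P_{i+1} - c^i P_i, and P_0 = 0.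

open import Defs
open import Data.Nat using (ℕ; zero; suc)
open import Data.Product using (_×_; _,_)
open import Relation.Nullary using (¬_)
open import Algebra.Bundles using (CommutativeRing)
import Algebra.Properties.CommutativeSemigroup as CommutativeSemigroupProperties
import Relation.Binary.Reasoning.Setoid as SetoidReasoning

module PellSums {a ℓ} (R : CommutativeRing a ℓ) where
  open CommutativeRing R hiding (zero)
  open PellRing R
  open CommutativeSemigroupProperties +-commutativeSemigroup
  open SetoidReasoning setoid

  sumTo-telescope : (f g : ℕ → Carrier) → (∀ i → f i + g i ≈ g (suc i)) →
                    ∀ m → sumTo f m + g 0 ≈ g (suc m)
  sumTo-telescope f g step zero = step 0
  sumTo-telescope f g step (suc m) = begin
    (sumTo f m + f (suc m)) + g 0  ≈⟨ xy∙z≈xz∙y _ _ _ ⟩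
    (sumTo f m + g 0) + f (suc m)  ≈⟨ +-congʳ (sumTo-telescope f g step m) ⟩
    g (suc m) + f (suc m)          ≈⟨ +-comm _ _ ⟩
    f (suc m) + g (suc m)          ≈⟨ step (suc m) ⟩
    g (suc (suc m))                ∎

  sumTo-telescope-from-0 : (f g : ℕ → Carrier) → g 0 ≈ 0# → (∀ i → f i + g i ≈ g (suc i)) →
                           ∀ m → sumTo f m ≈ g (suc m)
  sumTo-telescope-from-0 f g g0≈0 step m = begin
    sumTo f m        ≈⟨ sym (+-identityʳ _) ⟩
    sumTo f m + 0#   ≈⟨ +-congˡ (sym g0≈0) ⟩
    sumTo f m + g 0  ≈⟨ sumTo-telescope f g step m ⟩
    g (suc m)        ∎

  two*x≈x+x : ∀ x → two * x ≈ x + x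
  two*x≈x+x x = trans (distribʳ x 1# 1#) (+-cong (*-identityˡ x) (*-identityˡ x))

  pellLucas+two*pell : ∀ n → pellLucas n + two * pell n ≈ two * pell (suc n)
  pellLucas+two*pell zero = begin
    two + two * 0#  ≈⟨ +-congˡ (zeroʳ two) ⟩
    two + 0#        ≈⟨ +-identityʳ two ⟩
    two             ≈⟨ sym (*-identityʳ two) ⟩
    two * 1#        ∎
  pellLucas+two*pell (suc zero) = begin
    two + two * 1#         ≈⟨ +-congˡ (*-identityʳ two) ⟩
    two + two              ≈⟨ sym (two*x≈x+x two) ⟩
    two * two              ≈⟨ *-congˡ (sym (trans (+-identityʳ _) (*-identityʳ two))) ⟩
    two * (two * 1# + 0#)  ∎
  pellLucas+two*pell (suc (suc n)) = begin
    (two * Q₁ + Q₀) + two * (two * P₁ + P₀)          ≈⟨ +-congˡ (distribˡ two (two * P₁) P₀) ⟩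
    (two * Q₁ + Q₀) + (two * (two * P₁) + two * P₀)  ≈⟨ interchange _ _ _ _ ⟩
    (two * Q₁ + two * (two * P₁)) + (Q₀ + two * P₀)  ≈⟨ +-congʳ (sym (distribˡ two Q₁ (two * P₁))) ⟩
    two * (Q₁ + two * P₁) + (Q₀ + two * P₀)          ≈⟨ +-cong (*-congˡ (pellLucas+two*pell (suc n)))
                                                                (pellLucas+two*pell n) ⟩
    two * (two * pell (suc (suc n))) + two * P₁      ≈⟨ sym (distribˡ two _ _) ⟩
    two * (two * pell (suc (suc n)) + P₁)            ∎
    where
    Q₁ = pellLucas (suc n)
    Q₀ = pellLucas n
    P₁ = pell (suc n)
    P₀ = pell n

  pell+pellLucas+pell : ∀ n → (pell n + pellLucas n) + pell n ≈ two * pell (suc n)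
  pell+pellLucas+pell n = begin
    (P + Q) + P      ≈⟨ xy∙z≈y∙xz P Q P ⟩
    Q + (P + P)      ≈⟨ +-congˡ (sym (two*x≈x+x P)) ⟩
    Q + two * P      ≈⟨ pellLucas+two*pell n ⟩
    two * pell (suc n) ∎
    where
    P = pell n
    Q = pellLucas n

  x-two+two≈x : ∀ x → (x - two) + two ≈ x
  x-two+two≈x x = begin
    (x - two) + two    ≈⟨ +-assoc x (- two) two ⟩
    x + (- two + two)  ≈⟨ +-congˡ (-‿inverseˡ two) ⟩
    x + 0#             ≈⟨ +-identityʳ x ⟩
    x                  ∎

  pell-summand-c : ∀ c n →
    ((pell n + (c - two) * pell (suc n)) + pellLucas n) + pell n ≈ c * pell (suc n)
  pell-summand-c c n = begin
    ((P + d * P′) + Q) + P   ≈⟨ +-congʳ (+-congʳ (+-comm P _)) ⟩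
    ((d * P′ + P) + Q) + P   ≈⟨ +-assoc _ Q P ⟩
    (d * P′ + P) + (Q + P)   ≈⟨ +-assoc _ P _ ⟩
    d * P′ + (P + (Q + P))   ≈⟨ +-congˡ (sym (+-assoc P Q P)) ⟩
    d * P′ + ((P + Q) + P)   ≈⟨ +-congˡ (pell+pellLucas+pell n) ⟩
    d * P′ + two * P′        ≈⟨ sym (distribʳ P′ d two) ⟩
    (d + two) * P′           ≈⟨ *-congʳ (x-two+two≈x c) ⟩
    c * P′                   ∎
    where
    P = pell n
    P′ = pell (suc n)
    Q = pellLucas n
    d = c - two

  pow-*-step : ∀ c n x u v → x + u ≈ c * v → pow c n * x + pow c n * u ≈ pow c (suc n) * v
  pow-*-step c n x u v x+u≈cv = begin
    cⁿ * x + cⁿ * u  ≈⟨ sym (distribˡ cⁿ x u) ⟩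
    cⁿ * (x + u)     ≈⟨ *-congˡ x+u≈cv ⟩
    cⁿ * (c * v)     ≈⟨ sym (*-assoc cⁿ c v) ⟩
    (cⁿ * c) * v     ≈⟨ *-congʳ (*-comm cⁿ c) ⟩
    (c * cⁿ) * v     ∎
    where
    cⁿ = pow c n

  pow*pell-telescope : ∀ c (f : ℕ → Carrier) →
    (∀ i → f i + pow c i * pell i ≈ pow c (suc i) * pell (suc i)) →
    ∀ m → pow c (suc m) * pell (suc m) ≈ sumTo f m
  pow*pell-telescope c f step m =
    sym (sumTo-telescope-from-0 f (λ i → pow c i * pell i) (zeroʳ 1#) step m)

-- The hypothesis c ≉ 0 is unused: the identity is polynomial in c.
corollary4 : ∀ {a ℓ} (R : CommutativeRing a ℓ) →
  let open CommutativeRing R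
      open PellRing R
  in ((m : ℕ) (c : Carrier) → ¬ (c ≈ 0#) →
        pow c (suc m) * pell (suc m)
          ≈ sumTo (λ i → pow c i * (pell i + (c - two) * pell (suc i) + pellLucas i)) m)
     × ((m : ℕ) →
        pow two (suc m) * pell (suc m)
          ≈ sumTo (λ i → pow two i * (pell i + pellLucas i)) m)
corollary4 R =
    (λ m c _ → pow*pell-telescope c _ (λ i → pow-*-step c i _ _ _ (pell-summand-c c i)) m)
  , (λ m → pow*pell-telescope two _ (λ i → pow-*-step two i _ _ _ (pell+pellLucas+pell i)) m)
  where
  open PellRing R using (two)
  open PellSums R
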